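{- Let $n\ge 3$ and $2\le k\le n-1$. An oriented cycle $\overrightarrow{C_n}$ is $\{k\}$-antimagic if and only if it is unidirectional.
   Context: An oriented cycle $\overrightarrow{C_n}$ is an orientation of the cycle on vertices $v_1,\dots,v_n$. $d(u,y)$ denotes the length of a shortest directed path from $u$ to $y$ ($d(u,u)=0$, $\infty$ if none). For a nonempty set $D$ of distances, $N_D(v)=\{y : d(v,y)\in D\}$, and a bijection $f:V\to\{1,\dots,n\}$ is $D$-antimagic if the $D$-weights $\omega_D(v)=\sum_{y\in N_D(v)}f(y)$ are pairwise distinct; the graph is $D$-antimagic if such a bijection exists. The cycle is unidirectional if (for a suitable labeling of its vertices) its arc set is $\{(v_i,v_{i+1}):1\le i\le n-1\}\cup\{(v_n,v_1)\}$. -}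

module Defs where

open import Data.Nat using (ℕ; zero; suc; _<_)
open import Data.Nat.DivMod using (_mod_)
open import Data.Bool using (Bool; true; false; _∧_; _∨_; not; if_then_else_)
open import Data.Fin using (Fin; toℕ; _≟_)
open import Data.Fin.Permutation using (Permutation′; _⟨$⟩ʳ_)
open import Data.List using (List; []; _∷_; map; allFin; upTo)
open import Data.Bool.ListAction using (any)
open import Data.Nat.ListAction using (sum)
open import Data.Product using (Σ; ∃; _×_)
open import Relation.Nullary.Decidable using (⌊_⌋)
open import Relation.Binary.PropositionalEquality using (_≡_)
open import Function.Bundles using (_⇔_)

-- Vertices v_1..v_n are represented by Fin n (v_{i+1} ↦ i).
-- Cyclic successor on vertices: i ↦ i+1 mod n.
next : ∀ {n} → Fin n → Fin n
next {suc m} i = suc (toℕ i) mod (suc m)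

-- An oriented cycle on n vertices: for each cycle edge {i, next i},
-- o i = true means the arc is (i, next i); false means (next i, i).
Orientation : ℕ → Set
Orientation n = Fin n → Bool

arc : ∀ {n} → Orientation n → Fin n → Fin n → Bool
arc o u w = (o u ∧ ⌊ w ≟ next u ⌋) ∨ (not (o w) ∧ ⌊ u ≟ next w ⌋)

walk : ∀ {n} → Orientation n → ℕ → Fin n → Fin n → Bool
walk {n} o zero    u y = ⌊ u ≟ y ⌋
walk {n} o (suc m) u y = any (λ x → arc o u x ∧ walk o m x y) (allFin n)

-- distIs o m u y : d(u,y) = m, i.e. a directed walk (equivalently path)
-- of length m from u to y exists and none of smaller length does.
distIs : ∀ {n} → Orientation n → ℕ → Fin n → Fin n → Bool
distIs o m u y = walk o m u y ∧ not (any (λ j → walk o j u y) (upTo m))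

inN : ∀ {n} → Orientation n → List ℕ → Fin n → Fin n → Bool
inN o D v y = any (λ m → distIs o m v y) D

-- Labelling: bijection f : V → {1..n}, encoded as a permutation π of Fin n
-- with f(y) = 1 + toℕ (π y).
label : ∀ {n} → Permutation′ n → Fin n → ℕ
label π y = suc (toℕ (π ⟨$⟩ʳ y))

weight : ∀ {n} → Orientation n → List ℕ → Permutation′ n → Fin n → ℕ
weight {n} o D π v =
  sum (map (λ y → if inN o D v y then label π y else 0) (allFin n))

IsDAntimagicLabeling : ∀ {n} → Orientation n → List ℕ → Permutation′ n → Set
IsDAntimagicLabeling o D π = ∀ u v → weight o D π u ≡ weight o D π v → u ≡ v

DAntimagic : ∀ {n} → Orientation n → List ℕ → Set
DAntimagic {n} o D = Σ (Permutation′ n) (λ π → IsDAntimagicLabeling o D π)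

Unidirectional : ∀ {n} → Orientation n → Set
Unidirectional {n} o =
  Σ (Permutation′ n) λ σ → ∀ u w →
    (arc o u w ≡ true) ⇔ (∃ λ i → u ≡ σ ⟨$⟩ʳ i × w ≡ σ ⟨$⟩ʳ next i)

-- A vertex is a sink exactly where a forward arc meets a backward one, so every orientation
-- except the two constant (unidirectional) ones has a sink.  A sink, and a vertex whose only
-- out-neighbour is a sink, start no walk of length k ≥ 2 and therefore have {k}-weight 0 under
-- every labelling; since n ≥ 3, looking at the two in-neighbours of a sink always produces two
-- such vertices.  In a unidirectional cycle the only vertex at distance k < n from v is its k-th
-- successor, so the identity labelling gives v the weight 1 + (index of that successor), and
-- taking k-th successors is injective.

module Submission where

open import Defs
open import Data.Nat using (ℕ; _≤_; _∸_)
open import Data.List using ([]; _∷_)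
open import Function.Bundles using (_⇔_)

open import Data.Nat using (zero; suc; _+_; _*_; _<_; z≤n; z<s; s≤s; s≤s⁻¹; NonZero)
open import Data.Nat.Properties hiding (_≟_)
open import Algebra.Properties.CommutativeSemigroup +-commutativeSemigroup using (x∙yz≈y∙xz)
open import Data.Nat.DivMod
  using (_%_; _/_; m≡m%n+[m/n]*n; %-distribˡ-+; m%n%n≡m%n; [m+n]%n≡m%n; m<n⇒m%n≡m; m≤n⇒m%n≡m; n%n≡0)
open import Data.Nat.ListAction using (sum)
open import Data.Bool using (Bool; true; false; _∧_; if_then_else_)
open import Data.Bool.ListAction using (any)
open import Data.Bool.Properties using (T-≡; T-not-≡; T-∧; T-∨; ¬-not) renaming (_≟_ to _≟ᵇ_)
open import Data.Fin using (Fin; toℕ; opposite) renaming (zero to fzero; suc to fsuc)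
open import Data.Fin.Properties
  using (toℕ-injective; toℕ-fromℕ<; toℕ<n; all?; ¬∀⟶∃¬; opposite-prop; opposite-involutive)
  renaming (suc-injective to fsuc-injective)
open import Data.Fin.Permutation using (Permutation′; _⟨$⟩ʳ_; _⟨$⟩ˡ_; inverseˡ; inverseʳ; reverse)
  renaming (id to idₚ)
open import Data.List using (map; allFin; upTo; tabulate)
open import Data.List.Properties using (map-tabulate)
open import Data.List.Membership.Propositional using (_∈_)
open import Data.List.Membership.Propositional.Properties using (∈-allFin; ∈-upTo⁻)
open import Data.List.Relation.Unary.Any using (here; there)
open import Data.Product using (∃; ∃₂; _×_; _,_; proj₁)
open import Data.Sum using (_⊎_; inj₁; inj₂)
open import Function using (_∘_; id; Injective; mk⇔; Equivalence)
open import Relation.Nullary using (yes; no; contradiction)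
open import Relation.Nullary.Decidable using (toWitness; fromWitness)
open import Relation.Binary.PropositionalEquality

open Equivalence using (to; from)

true≢false : true ≢ false
true≢false ()

module _ {A : Set} (p : A → Bool) where

  any-≡false : ∀ xs → (∀ {x} → x ∈ xs → p x ≡ false) → any p xs ≡ false
  any-≡false []       _ = refl
  any-≡false (x ∷ xs) h rewrite h (here refl) = any-≡false xs (h ∘ there)

  any-≡true⁻ : ∀ xs → any p xs ≡ true → ∃ λ x → p x ≡ true
  any-≡true⁻ (x ∷ xs) e with p x in px
  ... | true  = x , px
  ... | false = any-≡true⁻ xs e

  any-≡true⁺ : ∀ {xs x} → x ∈ xs → p x ≡ true → any p xs ≡ true
  any-≡true⁺ (here refl) e rewrite e = refl
  any-≡true⁺ {y ∷ _} (there x∈xs) e with p y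
  ... | true  = refl
  ... | false = any-≡true⁺ x∈xs e

sum-tabulate-≡0 : ∀ {n} (g : Fin n → ℕ) → (∀ y → g y ≡ 0) → sum (tabulate g) ≡ 0
sum-tabulate-≡0 {zero}  g _ = refl
sum-tabulate-≡0 {suc n} g h rewrite h fzero = sum-tabulate-≡0 (g ∘ fsuc) (h ∘ fsuc)

sum-tabulate-single : ∀ {n} (g : Fin n → ℕ) c → (∀ y → y ≢ c → g y ≡ 0) →
                      sum (tabulate g) ≡ g c
sum-tabulate-single g fzero h
  rewrite sum-tabulate-≡0 (g ∘ fsuc) (λ y → h (fsuc y) λ ()) = +-identityʳ (g fzero)
sum-tabulate-single g (fsuc c) h
  rewrite h fzero (λ ()) =
    sum-tabulate-single (g ∘ fsuc) c (λ y y≢c → h (fsuc y) (y≢c ∘ fsuc-injective))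

sum-map-allFin : ∀ {n} (g : Fin n → ℕ) → sum (map g (allFin n)) ≡ sum (tabulate g)
sum-map-allFin g = cong sum (map-tabulate id g)

[1+m%n]%n≡[1+m]%n : ∀ m n .{{_ : NonZero n}} → suc (m % n) % n ≡ suc m % n
[1+m%n]%n≡[1+m]%n m n = begin
  (1 + m % n) % n           ≡⟨ %-distribˡ-+ 1 (m % n) n ⟩
  (1 % n + m % n % n) % n   ≡⟨ cong (λ r → (1 % n + r) % n) (m%n%n≡m%n m n) ⟩
  (1 % n + m % n) % n       ≡⟨ %-distribˡ-+ 1 m n ⟨
  (1 + m) % n               ∎
  where open ≡-Reasoning

-- Writing (m + n) = ((m + n) / o) * o + m shows that n is a multiple of o.
[m+n]%o≢m : ∀ m {n o} .{{_ : NonZero o}} → 0 < n → n < o → (m + n) % o ≢ m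
[m+n]%o≢m m {n} {o} 0<n n<o eq = not-multiple ((m + n) / o) n≡q*o
  where
  n≡q*o : n ≡ (m + n) / o * o
  n≡q*o = +-cancelˡ-≡ m _ _ (begin
    m + n                          ≡⟨ m≡m%n+[m/n]*n (m + n) o ⟩
    (m + n) % o + (m + n) / o * o  ≡⟨ cong (_+ (m + n) / o * o) eq ⟩
    m + (m + n) / o * o            ∎)
    where open ≡-Reasoning
  not-multiple : ∀ q → n ≢ q * o
  not-multiple zero    n≡0 = n≮n 0 (subst (0 <_) n≡0 0<n)
  not-multiple (suc q) n≡o+ = n≮n o (≤-<-trans (m≤m+n o (q * o)) (subst (_< o) n≡o+ n<o))

module Iteration {A : Set} (f : A → A) where

  open import Function.Endo.Propositional A using (_^_; ^-homo)

  ^-+ : ∀ t d x → (f ^ t) ((f ^ d) x) ≡ (f ^ (t + d)) x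
  ^-+ t d x = sym (cong-app (^-homo f t d) x)

  ^-comm : ∀ t x → (f ^ t) (f x) ≡ f ((f ^ t) x)
  ^-comm t x = trans (^-+ t 1 x) (cong (λ s → (f ^ s) x) (+-comm t 1))

  ^-injective : Injective _≡_ _≡_ f → ∀ t → Injective _≡_ _≡_ (f ^ t)
  ^-injective f-inj zero    eq = eq
  ^-injective f-inj (suc t) eq = ^-injective f-inj t (f-inj eq)

  descent-along : (b : A → Bool) → ∀ d x → b x ≡ true → b ((f ^ d) x) ≡ false →
                  ∃ λ t → t < d × b ((f ^ t) x) ≡ true × b (f ((f ^ t) x)) ≡ false
  descent-along b zero    x bx bd = contradiction (trans (sym bx) bd) true≢false
  descent-along b (suc d) x bx bd with b ((f ^ d) x) in e
  ... | true  = d , n<1+n d , e , bd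
  ... | false with descent-along b d x bx e
  ...   | t , t<d , bt , bt′ = t , m<n⇒m<1+n t<d , bt , bt′

module Cycle {m : ℕ} where

  open import Function.Endo.Propositional (Fin (suc m)) using (_^_)
  open Iteration (next {suc m}) using (^-+; ^-comm)

  private
    n = suc m

  toℕ-next : ∀ (x : Fin n) → toℕ (next x) ≡ suc (toℕ x) % n
  toℕ-next x = toℕ-fromℕ< _

  toℕ-next^ : ∀ t (x : Fin n) → toℕ ((next ^ t) x) ≡ (toℕ x + t) % n
  toℕ-next^ zero    x = sym (trans (cong (_% n) (+-identityʳ (toℕ x))) (m<n⇒m%n≡m (toℕ<n x)))
  toℕ-next^ (suc t) x = begin
    toℕ (next ((next ^ t) x))     ≡⟨ toℕ-next _ ⟩
    suc (toℕ ((next ^ t) x)) % n  ≡⟨ cong (λ r → suc r % n) (toℕ-next^ t x) ⟩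
    suc ((toℕ x + t) % n) % n     ≡⟨ [1+m%n]%n≡[1+m]%n (toℕ x + t) n ⟩
    suc (toℕ x + t) % n           ≡⟨ cong (_% n) (+-suc (toℕ x) t) ⟨
    (toℕ x + suc t) % n           ∎
    where open ≡-Reasoning

  prev : Fin n → Fin n
  prev = next ^ m

  next-prev : ∀ x → next (prev x) ≡ x
  next-prev x = toℕ-injective (begin
    toℕ ((next ^ n) x)  ≡⟨ toℕ-next^ n x ⟩
    (toℕ x + n) % n     ≡⟨ [m+n]%n≡m%n (toℕ x) n ⟩
    toℕ x % n           ≡⟨ m<n⇒m%n≡m (toℕ<n x) ⟩
    toℕ x               ∎)
    where open ≡-Reasoning

  prev-next : ∀ x → prev (next x) ≡ x
  prev-next x = trans (^-comm m x) (next-prev x)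

  next-injective : Injective _≡_ _≡_ (next {n})
  next-injective {x} {y} eq = trans (sym (prev-next x)) (trans (cong prev eq) (prev-next y))

  next^-irrefl : ∀ {t} x → 0 < t → t < n → (next ^ t) x ≢ x
  next^-irrefl {t} x 0<t t<n eq =
    [m+n]%o≢m (toℕ x) 0<t t<n (trans (sym (toℕ-next^ t x)) (cong toℕ eq))

  next^-distinct : ∀ {j k} x → j < k → k < n → (next ^ j) x ≢ (next ^ k) x
  next^-distinct {j} {k} x j<k k<n eq = next^-irrefl ((next ^ j) x)
    (m<n⇒0<n∸m j<k) (≤-<-trans (m∸n≤m k j) k<n) (begin
      (next ^ (k ∸ j)) ((next ^ j) x)  ≡⟨ ^-+ (k ∸ j) j x ⟩
      (next ^ (k ∸ j + j)) x           ≡⟨ cong (λ s → (next ^ s) x) (m∸n+n≡m (<⇒≤ j<k)) ⟩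
      (next ^ k) x                     ≡⟨ eq ⟨
      (next ^ j) x                     ∎)
    where open ≡-Reasoning

  next^-reaches : ∀ x y → ∃ λ t → (next ^ t) x ≡ y
  next^-reaches x y = toℕ y + (n ∸ toℕ x) , toℕ-injective (begin
    toℕ ((next ^ (toℕ y + (n ∸ toℕ x))) x)  ≡⟨ toℕ-next^ _ x ⟩
    (toℕ x + (toℕ y + (n ∸ toℕ x))) % n     ≡⟨ cong (_% n) (x∙yz≈y∙xz (toℕ x) (toℕ y) _) ⟩
    (toℕ y + (toℕ x + (n ∸ toℕ x))) % n     ≡⟨ cong (λ r → (toℕ y + r) % n) (m+[n∸m]≡n (<⇒≤ (toℕ<n x))) ⟩
    (toℕ y + n) % n                         ≡⟨ [m+n]%n≡m%n (toℕ y) n ⟩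
    toℕ y % n                               ≡⟨ m<n⇒m%n≡m (toℕ<n y) ⟩
    toℕ y                                   ∎)
    where open ≡-Reasoning

  next-opposite-next : ∀ (j : Fin n) → next (opposite (next j)) ≡ opposite j
  next-opposite-next j = toℕ-injective (go (m≤n⇒m<n∨m≡n (s≤s⁻¹ (toℕ<n j))))
    where
    open ≡-Reasoning
    t = toℕ j
    go : t < m ⊎ t ≡ m → toℕ (next (opposite (next j))) ≡ toℕ (opposite j)
    go (inj₁ t<m) = begin
      toℕ (next (opposite (next j)))      ≡⟨ toℕ-next _ ⟩
      suc (toℕ (opposite (next j))) % n   ≡⟨ cong (λ r → suc r % n) (opposite-prop (next j)) ⟩
      suc (m ∸ toℕ (next j)) % n          ≡⟨ cong (λ r → suc (m ∸ r) % n) next-j≡1+t ⟩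
      suc (m ∸ suc t) % n                 ≡⟨ cong (_% n) (+-∸-assoc 1 t<m) ⟨
      (m ∸ t) % n                         ≡⟨ m≤n⇒m%n≡m (m∸n≤m m t) ⟩
      m ∸ t                               ≡⟨ opposite-prop j ⟨
      toℕ (opposite j)                    ∎
      where
      next-j≡1+t : toℕ (next j) ≡ suc t
      next-j≡1+t = trans (toℕ-next j) (m≤n⇒m%n≡m t<m)
    go (inj₂ t≡m) = begin
      toℕ (next (opposite (next j)))      ≡⟨ toℕ-next _ ⟩
      suc (toℕ (opposite (next j))) % n   ≡⟨ cong (λ r → suc r % n) (opposite-prop (next j)) ⟩
      suc (m ∸ toℕ (next j)) % n          ≡⟨ cong (λ r → suc (m ∸ r) % n) next-j≡0 ⟩
      n % n                               ≡⟨ n%n≡0 n ⟩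
      0                                   ≡⟨ trans (cong (m ∸_) t≡m) (n∸n≡0 m) ⟨
      m ∸ t                               ≡⟨ opposite-prop j ⟨
      toℕ (opposite j)                    ∎
      where
      next-j≡0 : toℕ (next j) ≡ 0
      next-j≡0 = trans (toℕ-next j) (trans (cong (λ r → suc r % n) t≡m) (n%n≡0 n))

open Cycle

Sink : ∀ {n} → Orientation n → Fin n → Set
Sink o s = ∀ x → arc o s x ≢ true

DeadEnd : ∀ {n} → Orientation n → Fin n → Set
DeadEnd o v = ∀ x → arc o v x ≡ true → Sink o x

module Arcs {m : ℕ} (o : Orientation (suc m)) where

  private
    n = suc m

  arc⁻ : ∀ {u w} → arc o u w ≡ true → (o u ≡ true × w ≡ next u) ⊎ (o w ≡ false × u ≡ next w)
  arc⁻ e with to T-∨ (from T-≡ e)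
  ... | inj₁ forward  with to T-∧ forward
  ...   | ou , w≡ = inj₁ (to T-≡ ou , toWitness w≡)
  arc⁻ e | inj₂ backward with to T-∧ backward
  ...   | ow , u≡ = inj₂ (to T-not-≡ ow , toWitness u≡)

  arc-forward : ∀ {u} → o u ≡ true → arc o u (next u) ≡ true
  arc-forward ou = to T-≡ (from T-∨ (inj₁ (from T-∧ (from T-≡ ou , fromWitness refl))))

  arc-backward : ∀ {w} → o w ≡ false → arc o (next w) w ≡ true
  arc-backward ow = to T-≡ (from T-∨ (inj₂ (from T-∧ (from T-not-≡ ow , fromWitness refl))))

  sink⇒deadEnd : ∀ {s} → Sink o s → DeadEnd o s
  sink⇒deadEnd sink x e = contradiction e (sink x)

  sink-next : ∀ {i} → o i ≡ true → o (next i) ≡ false → Sink o (next i)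
  sink-next oi oi₁ x e with arc⁻ e
  ... | inj₁ (oi₁′ , _)  = true≢false (trans (sym oi₁′) oi₁)
  ... | inj₂ (ox , i₁≡x₁) = true≢false (trans (sym oi) (trans (cong o (next-injective i₁≡x₁)) ox))

  deadEnd-ahead-of-sink : ∀ {u v} → o u ≡ true → next u ≡ v → Sink o (next v) → DeadEnd o v
  deadEnd-ahead-of-sink ou u₁≡v sink x e with arc⁻ e
  ... | inj₁ (_ , x≡v₁)  = subst (Sink o) (sym x≡v₁) sink
  ... | inj₂ (ox , v≡x₁) =
    contradiction (trans (sym ou) (trans (cong o (next-injective (trans u₁≡v v≡x₁))) ox)) true≢false

  deadEnd-behind-sink : ∀ {s} → o (next s) ≡ false → Sink o s → DeadEnd o (next s)
  deadEnd-behind-sink os₁ sink x e with arc⁻ e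
  ... | inj₁ (os₁′ , _)  = contradiction (trans (sym os₁′) os₁) true≢false
  ... | inj₂ (_ , s₁≡x₁) = subst (Sink o) (next-injective s₁≡x₁) sink

  walk-from-sink : ∀ {s} → Sink o s → ∀ k y → walk o (suc k) s y ≡ false
  walk-from-sink sink k y = any-≡false _ (allFin n) λ {x} _ → cong (_∧ walk o k x y) (¬-not (sink x))

  walk-from-deadEnd : ∀ {v} → DeadEnd o v → ∀ k y → walk o (suc (suc k)) v y ≡ false
  walk-from-deadEnd {v} dead k y = any-≡false _ (allFin n) step
    where
    step : ∀ {x} → x ∈ allFin n → (arc o v x ∧ walk o (suc k) x y) ≡ false
    step {x} _ with arc o v x in e
    ... | true  = walk-from-sink (dead x e) k y
    ... | false = refl

  weight-deadEnd : ∀ {v} → DeadEnd o v → ∀ k π → weight o (suc (suc k) ∷ []) π v ≡ 0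
  weight-deadEnd {v} dead k π = trans (sum-map-allFin summand) (sum-tabulate-≡0 summand vanishes)
    where
    summand : Fin n → ℕ
    summand y = if inN o (suc (suc k) ∷ []) v y then label π y else 0
    vanishes : ∀ y → summand y ≡ 0
    vanishes y rewrite walk-from-deadEnd dead k y = refl

module Descents {m : ℕ} (o : Orientation (suc m)) where

  open import Function.Endo.Propositional (Fin (suc m)) using (_^_)
  open Iteration (next {suc m}) using (descent-along)

  Descent : Fin (suc m) → Set
  Descent i = o i ≡ true × o (next i) ≡ false

  constant-or-descent : (∀ i → o i ≡ true) ⊎ (∀ i → o i ≡ false) ⊎ ∃ Descent
  constant-or-descent with all? (λ i → o i ≟ᵇ true) | all? (λ i → o i ≟ᵇ false)
  ... | yes all-true | _             = inj₁ all-true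
  ... | no _         | yes all-false = inj₂ (inj₁ all-false)
  ... | no ¬all-true | no ¬all-false with ¬∀⟶∃¬ _ _ (λ i → o i ≟ᵇ true) ¬all-true
                                        | ¬∀⟶∃¬ _ _ (λ i → o i ≟ᵇ false) ¬all-false
  ...   | x , ox≢true | y , oy≢false with next^-reaches y x
  ...     | d , y→x with descent-along o d y (¬-not oy≢false) (trans (cong o y→x) (¬-not ox≢true))
  ...       | t , _ , ot , ot′ = inj₂ (inj₂ ((next ^ t) y , ot , ot′))

module _ {r : ℕ} (o : Orientation (3 + r)) where

  open import Function.Endo.Propositional (Fin (3 + r)) using (_^_)
  open Iteration (next {3 + r}) using (^-+; descent-along)
  open Arcs o
  open Descents o using (Descent)

  -- The sink next i has the in-neighbours i and next (next i).  Unless one of them is a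
  -- dead end, both are sources, and walking from next (next i) to prev i meets a second sink.
  descent⇒two-deadEnds : ∀ {i} → Descent i → ∃₂ λ u v → u ≢ v × DeadEnd o u × DeadEnd o v
  descent⇒two-deadEnds {i} (oi , oi₁) with o (next (next i)) in oi₂ | o (prev i) in oi₋₁
  ... | false | _    = next i , next (next i) , ≢-sym (next^-irrefl {t = 1} (next i) z<s (s≤s (s≤s z≤n)))
                     , sink⇒deadEnd sink , deadEnd-behind-sink oi₂ sink
    where sink = sink-next oi oi₁
  ... | true  | true = i , next i , ≢-sym (next^-irrefl {t = 1} i z<s (s≤s (s≤s z≤n)))
                     , deadEnd-ahead-of-sink oi₋₁ (next-prev i) sink , sink⇒deadEnd sink
    where sink = sink-next oi oi₁
  ... | true  | false with descent-along o r (next (next i)) oi₂ (trans (cong o path-to-prev) oi₋₁)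
    where
    path-to-prev : (next ^ r) (next (next i)) ≡ prev i
    path-to-prev = trans (^-+ r 2 i) (cong (λ s → (next ^ s) i) (+-comm r 2))
  ...   | t , t<r , oy , oy₁ =
    next i , next y , sinks-distinct , sink⇒deadEnd (sink-next oi oi₁) , sink⇒deadEnd (sink-next oy oy₁)
    where
    y = (next ^ t) (next (next i))
    sinks-distinct : next i ≢ next y
    sinks-distinct eq = next^-irrefl i (subst (0 <_) (+-comm 2 t) z<s)
                          (subst (_< 3 + r) (+-comm 2 t) (s≤s (s≤s (m<n⇒m<1+n t<r))))
                          (trans (sym (^-+ t 2 i)) (sym (next-injective eq)))

module _ {m : ℕ} (o : Orientation (suc m)) where

  open Arcs o

  all-true⇒unidirectional : (∀ i → o i ≡ true) → Unidirectional o
  all-true⇒unidirectional all-true = idₚ , λ u w → mk⇔ along against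
    where
    along : ∀ {u w} → arc o u w ≡ true → ∃ λ i → u ≡ i × w ≡ next i
    along {u} e with arc⁻ e
    ... | inj₁ (_ , w≡u′) = u , refl , w≡u′
    ... | inj₂ (ow , _)   = contradiction (trans (sym (all-true _)) ow) true≢false
    against : ∀ {u w} → (∃ λ i → u ≡ i × w ≡ next i) → arc o u w ≡ true
    against (i , refl , refl) = arc-forward (all-true i)

  -- reverse ⟨$⟩ʳ i is opposite i, the reflection i ↦ m ∸ i, which turns the cycle around.
  all-false⇒unidirectional : (∀ i → o i ≡ false) → Unidirectional o
  all-false⇒unidirectional all-false = reverse , λ u w → mk⇔ along against
    where
    along : ∀ {u w} → arc o u w ≡ true → ∃ λ i → u ≡ opposite i × w ≡ opposite (next i)
    along {u} {w} e with arc⁻ e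
    ... | inj₁ (ou , _)    = contradiction (trans (sym ou) (all-false u)) true≢false
    ... | inj₂ (_ , u≡w₁) =
      opposite (next w) , trans u≡w₁ (sym (opposite-involutive (next w)))
                        , trans (sym (opposite-involutive w)) (cong opposite (sym (next-opposite-next w)))
    against : ∀ {u w} → (∃ λ i → u ≡ opposite i × w ≡ opposite (next i)) → arc o u w ≡ true
    against (i , refl , refl) =
      subst (λ v → arc o v (opposite (next i)) ≡ true) (next-opposite-next i) (arc-backward (all-false _))

  antimagic⇒unidirectional : ∀ {k} → 3 ≤ suc m → 2 ≤ k → DAntimagic o (k ∷ []) → Unidirectional o
  antimagic⇒unidirectional {suc (suc k)} (s≤s (s≤s (s≤s _))) _ (π , antimagic)
    with Descents.constant-or-descent o
  ... | inj₁ all-true             = all-true⇒unidirectional all-true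
  ... | inj₂ (inj₁ all-false)     = all-false⇒unidirectional all-false
  ... | inj₂ (inj₂ (_ , descent)) with descent⇒two-deadEnds o descent
  ...   | u , v , u≢v , dead-u , dead-v =
    contradiction (antimagic u v (trans (weight-deadEnd dead-u k π) (sym (weight-deadEnd dead-v k π)))) u≢v
  antimagic⇒unidirectional {zero}     _ ()             _
  antimagic⇒unidirectional {suc zero} _ (s≤s ())       _

module UnidirectionalWalks {m : ℕ} (o : Orientation (suc m)) (σ : Permutation′ (suc m))
  (arc⇔ : ∀ u w → (arc o u w ≡ true) ⇔ (∃ λ i → u ≡ σ ⟨$⟩ʳ i × w ≡ σ ⟨$⟩ʳ next i)) where

  open import Function.Endo.Propositional (Fin (suc m)) using (_^_)

  private
    n = suc m

  σ-injective : Injective _≡_ _≡_ (σ ⟨$⟩ʳ_)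
  σ-injective eq = trans (sym (inverseˡ σ)) (trans (cong (σ ⟨$⟩ˡ_) eq) (inverseˡ σ))

  successor : Fin n → Fin n
  successor u = σ ⟨$⟩ʳ next (σ ⟨$⟩ˡ u)

  open Iteration successor using (^-comm; ^-injective)

  arc-successor : ∀ u → arc o u (successor u) ≡ true
  arc-successor u = from (arc⇔ u (successor u)) (σ ⟨$⟩ˡ u , sym (inverseʳ σ) , refl)

  arc⇒successor : ∀ {u w} → arc o u w ≡ true → w ≡ successor u
  arc⇒successor {u} {w} e with to (arc⇔ u w) e
  ... | i , refl , refl = cong (λ j → σ ⟨$⟩ʳ next j) (sym (inverseˡ σ))

  successor^ : ∀ j u → (successor ^ j) u ≡ σ ⟨$⟩ʳ (next ^ j) (σ ⟨$⟩ˡ u)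
  successor^ zero    u = sym (inverseʳ σ)
  successor^ (suc j) u = begin
    successor ((successor ^ j) u)                          ≡⟨ cong successor (successor^ j u) ⟩
    σ ⟨$⟩ʳ next (σ ⟨$⟩ˡ (σ ⟨$⟩ʳ (next ^ j) (σ ⟨$⟩ˡ u)))
      ≡⟨ cong (λ x → σ ⟨$⟩ʳ next x) (inverseˡ σ) ⟩
    σ ⟨$⟩ʳ next ((next ^ j) (σ ⟨$⟩ˡ u))                   ∎
    where open ≡-Reasoning

  walk-successor^ : ∀ j u → walk o j u ((successor ^ j) u) ≡ true
  walk-successor^ zero    u = to T-≡ (fromWitness refl)
  walk-successor^ (suc j) u = any-≡true⁺ _ (∈-allFin (successor u)) (cong₂ _∧_ (arc-successor u) walk-on)
    where
    walk-on : walk o j (successor u) (successor ((successor ^ j) u)) ≡ true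
    walk-on = subst (λ y → walk o j (successor u) y ≡ true) (^-comm j u) (walk-successor^ j (successor u))

  walk⇒successor^ : ∀ j {u y} → walk o j u y ≡ true → y ≡ (successor ^ j) u
  walk⇒successor^ zero    e = sym (toWitness (from T-≡ e))
  walk⇒successor^ (suc j) {u} e with any-≡true⁻ _ (allFin n) e
  ... | x , e′ with to T-∧ (from T-≡ e′)
  ...   | ux , xy = trans (walk⇒successor^ j (to T-≡ xy))
                      (trans (cong (successor ^ j) (arc⇒successor (to T-≡ ux))) (^-comm j u))

  successor^-distinct : ∀ {j k} u → j < k → k < n → (successor ^ j) u ≢ (successor ^ k) u
  successor^-distinct {j} {k} u j<k k<n eq = next^-distinct (σ ⟨$⟩ˡ u) j<k k<n
    (σ-injective (trans (sym (successor^ j u)) (trans eq (successor^ k u))))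

  successor-injective : Injective _≡_ _≡_ successor
  successor-injective eq =
    trans (sym (inverseʳ σ)) (trans (cong (σ ⟨$⟩ʳ_) (next-injective (σ-injective eq))) (inverseʳ σ))

  module _ {k : ℕ} (k<n : k < n) where

    no-shorter-walk : ∀ u {j} → j ∈ upTo k → walk o j u ((successor ^ k) u) ≡ false
    no-shorter-walk u {j} j∈ =
      ¬-not λ e → successor^-distinct u (∈-upTo⁻ j∈) k<n (sym (walk⇒successor^ j e))

    inN-successor^ : ∀ u → inN o (k ∷ []) u ((successor ^ k) u) ≡ true
    inN-successor^ u rewrite walk-successor^ k u | any-≡false _ (upTo k) (no-shorter-walk u) = refl

    inN⇒successor^ : ∀ {u y} → inN o (k ∷ []) u y ≡ true → y ≡ (successor ^ k) u
    inN⇒successor^ e with to T-∨ (from T-≡ e)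
    ... | inj₁ at-distance-k = walk⇒successor^ k (to T-≡ (proj₁ (to T-∧ at-distance-k)))

    weight-id : ∀ u → weight o (k ∷ []) idₚ u ≡ suc (toℕ ((successor ^ k) u))
    weight-id u = begin
      weight o (k ∷ []) idₚ u  ≡⟨ sum-map-allFin summand ⟩
      sum (tabulate summand)   ≡⟨ sum-tabulate-single summand target vanishes ⟩
      summand target           ≡⟨ cong (λ b → if b then suc (toℕ target) else 0) (inN-successor^ u) ⟩
      suc (toℕ target)         ∎
      where
      open ≡-Reasoning
      target = (successor ^ k) u
      summand : Fin n → ℕ
      summand y = if inN o (k ∷ []) u y then label idₚ y else 0
      vanishes : ∀ y → y ≢ target → summand y ≡ 0
      vanishes y y≢ = cong (λ b → if b then label idₚ y else 0) (¬-not (y≢ ∘ inN⇒successor^))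

    antimagic : DAntimagic o (k ∷ [])
    antimagic = idₚ , λ u v eq → ^-injective successor-injective k
      (toℕ-injective (suc-injective (trans (sym (weight-id u)) (trans eq (weight-id v)))))

unidirectional⇒antimagic : ∀ {m k} (o : Orientation (suc m)) → k < suc m →
                           Unidirectional o → DAntimagic o (k ∷ [])
unidirectional⇒antimagic o k<n (σ , arc⇔) = UnidirectionalWalks.antimagic o σ arc⇔ k<n

mainTheorem2 : (n : ℕ) → 3 ≤ n → (k : ℕ) → 2 ≤ k → k ≤ n ∸ 1 →
    (o : Orientation n) → DAntimagic o (k ∷ []) ⇔ Unidirectional o
mainTheorem2 (suc m) 3≤n k 2≤k k≤m o =
  mk⇔ (antimagic⇒unidirectional o 3≤n 2≤k) (unidirectional⇒antimagic o (s≤s k≤m))
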